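{- Let $P\subseteq\Phi_{B_n}$ be a signed poset. If $\widehat G_C(P^\vee)$ has an isotropic connected component, then the signed graph $\Sigma_P$ has a balanced connected component.
   Context: $\Phi_{B_n}=\{\pm e_i\pm e_j:i<j\}\cup\{\pm e_i\}$. A signed poset is $P\subseteq\Phi_{B_n}$ with $\alpha\in P\Rightarrow-\alpha\notin P$ and $P=\mathbb{R}_{\ge0}P\cap\Phi_{B_n}$; $P^\vee=\{2\alpha/\langle\alpha,\alpha\rangle\}$. $\widehat G_C(P^\vee)$ is the partial order on $\pm[n]$ generated by $\delta i<\epsilon j$, $-\epsilon j<-\delta i$ whenever $\delta e_i-\epsilon e_j\in P^\vee$ ($i\neq j$) and $\delta i<-\delta i$ whenever $2\delta e_i\in P^\vee$. A subset of $\pm[n]$ is isotropic if it contains no pair $i,-i$. $\Sigma_P$ has vertex set $[n]$ and one edge for each $\alpha\in P$ that is not a nonnegative combination of $P\setminus\{\alpha\}$: $\pm(e_i-e_j)$ gives an edge $\{i,j\}$ of sign $+$, $\pm(e_i+e_j)$ an edge $\{i,j\}$ of sign $-$, $\pm e_i$ a loop at $i$ of sign $-$. A signed graph (or component) is balanced if every cycle in it has an even number of edges of sign $-$. -}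

module Defs where

open import Data.Nat using (ℕ; zero; suc)
open import Data.Nat.DivMod using (_%_)
open import Data.Integer as ℤ using (ℤ; +_)
open import Data.Fin using (Fin; _<_; inject₁; fromℕ) renaming (_≟_ to _≟ᶠ_)
open import Data.Fin as F using ()
open import Data.Bool using (Bool; true; false; if_then_else_)
open import Data.Product using (Σ; ∃; _×_; _,_)
open import Data.Sum using (_⊎_)
open import Data.List using (List; []; _∷_; map; allFin)
open import Data.Nat.ListAction using (sum)
open import Data.List.Relation.Unary.All using (All)
open import Data.Empty using (⊥)
open import Relation.Nullary using (¬_; does)
open import Relation.Binary.PropositionalEquality using (_≡_; _≢_)
open import Relation.Binary.Construct.Closure.ReflexiveTransitive using (Star)
open import Function.Definitions using (Injective)

data Sign : Set where
  plus minus : Sign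

flipS : Sign → Sign
flipS plus  = minus
flipS minus = plus

sgn : Sign → ℤ
sgn plus  = + 1
sgn minus = ℤ.- (+ 1)

-- The root system Φ_{B_n}.
--   long s t i j _  is the root  s e_i + t e_j   (i < j)
--   short s i       is the root  s e_i

data Root (n : ℕ) : Set where
  long  : (s t : Sign) (i j : Fin n) → i < j → Root n
  short : (s : Sign) (i : Fin n) → Root n

negR : ∀ {n} → Root n → Root n
negR (long s t i j p) = long (flipS s) (flipS t) i j p
negR (short s i)      = short (flipS s) i

unit : ∀ {n} → Sign → Fin n → Fin n → ℤ
unit s j m = if does (m ≟ᶠ j) then sgn s else + 0

vec : ∀ {n} → Root n → Fin n → ℤ
vec (long s t i j _) m = unit s i m ℤ.+ unit t j m
vec (short s i)      m = unit s i m

-- Since all vectors involved are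
-- integral, v ∈ ℝ≥0 S iff (suc k) · v is a ℕ-combination of elements of S
-- for some k (rational cone = real cone ∩ ℚ^n; clear denominators).

combo : ∀ {n} → List (ℕ × Root n) → Fin n → ℤ
combo []             m = + 0
combo ((c , β) ∷ cs) m = (+ c) ℤ.* vec β m ℤ.+ combo cs m

InCone : ∀ {n} → (Root n → Set) → (Fin n → ℤ) → Set
InCone {n} S v =
  Σ ℕ λ k → Σ (List (ℕ × Root n)) λ cs →
    All (λ p → S (Data.Product.proj₂ p)) cs ×
    (∀ m → (+ suc k) ℤ.* v m ≡ combo cs m)

_∈P_ : ∀ {n} → Root n → (Root n → Bool) → Set
α ∈P P = P α ≡ true

record IsSignedPoset {n : ℕ} (P : Root n → Bool) : Set where
  field
    antisym : ∀ α → α ∈P P → ¬ (negR α ∈P P)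
    closed  : ∀ α → InCone (λ β → β ∈P P) (vec α) → α ∈P P

-- Coroots: long roots are their own coroots; (s e_i)^∨ = 2 s e_i.
-- For the coroot s e_i + t e_j = δ e_i - ε e_j (δ = s, ε = -t):
--   δ i < ε j      i.e.  (s,i) < (-t,j)
--   -ε j < -δ i    i.e.  (t,j) < (-s,i)
-- For 2 s e_i:  s i < -s i.

SElt : ℕ → Set
SElt n = Sign × Fin n

data GenRel {n : ℕ} (P : Root n → Bool) : SElt n → SElt n → Set where
  gen-long₁ : ∀ s t i j (p : i < j) → long s t i j p ∈P P →
              GenRel P (s , i) (flipS t , j)
  gen-long₂ : ∀ s t i j (p : i < j) → long s t i j p ∈P P →
              GenRel P (t , j) (flipS s , i)
  gen-short : ∀ s i → short s i ∈P P →
              GenRel P (s , i) (flipS s , i)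

GCLe : ∀ {n} → (Root n → Bool) → SElt n → SElt n → Set
GCLe P = Star (GenRel P)

GCComparable : ∀ {n} → (Root n → Bool) → SElt n → SElt n → Set
GCComparable P x y = GCLe P x y ⊎ GCLe P y x

GCConn : ∀ {n} → (Root n → Bool) → SElt n → SElt n → Set
GCConn P = Star (GCComparable P)

IsotropicComponentOf : ∀ {n} → (Root n → Bool) → SElt n → Set
IsotropicComponentOf {n} P x =
  ¬ (Σ (Fin n) λ i → GCConn P x (plus , i) × GCConn P x (minus , i))

HasIsotropicComponent : ∀ {n} → (Root n → Bool) → Set
HasIsotropicComponent {n} P = Σ (SElt n) λ x → IsotropicComponentOf P x

IsEdge : ∀ {n} → (Root n → Bool) → Root n → Set
IsEdge P α = α ∈P P × ¬ InCone (λ β → β ∈P P × β ≢ α) (vec α)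

Joins : ∀ {n} → Root n → Fin n → Fin n → Set
Joins (long s t i j _) a b = (a ≡ i × b ≡ j) ⊎ (a ≡ j × b ≡ i)
Joins (short s i)      a b = a ≡ i × b ≡ i

isNeg : ∀ {n} → Root n → Bool
isNeg (long plus  plus  _ _ _) = true
isNeg (long minus minus _ _ _) = true
isNeg (long plus  minus _ _ _) = false
isNeg (long minus plus  _ _ _) = false
isNeg (short _ _)              = true

SigAdj : ∀ {n} → (Root n → Bool) → Fin n → Fin n → Set
SigAdj P a b = Σ _ λ α → IsEdge P α × Joins α a b

SigConn : ∀ {n} → (Root n → Bool) → Fin n → Fin n → Set
SigConn P = Star (SigAdj P)

-- A cycle of length suc k in Σ_P: vertices v 0 … v k with v k = v 0,
-- v 0 … v (k-1) pairwise distinct, pairwise distinct edges e 0 … e (k-1),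
-- edge e m joining v m and v (m+1).  (Length 1 = a loop, length 2 = two
-- parallel edges.)
record Cycle {n : ℕ} (P : Root n → Bool) (k : ℕ) : Set where
  field
    v      : Fin (suc (suc k)) → Fin n
    e      : Fin (suc k) → Root n
    closed : v (fromℕ (suc k)) ≡ v F.zero
    v-inj  : Injective _≡_ _≡_ (λ m → v (inject₁ m))
    e-inj  : Injective _≡_ _≡_ e
    e-edge : ∀ m → IsEdge P (e m)
    e-join : ∀ m → Joins (e m) (v (inject₁ m)) (v (F.suc m))

negCount : ∀ {n P k} → Cycle {n} P k → ℕ
negCount {k = k} c =
  sum (map (λ m → if isNeg (Cycle.e c m) then 1 else 0) (allFin (suc k)))

BalancedComponentOf : ∀ {n} → (Root n → Bool) → Fin n → Set
BalancedComponentOf P x =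
  ∀ k (c : Cycle P k) → (∀ m → SigConn P x (Cycle.v c m)) → negCount c % 2 ≡ 0

HasBalancedComponent : ∀ {n} → (Root n → Bool) → Set
HasBalancedComponent {n} P = Σ (Fin n) λ x → BalancedComponentOf P x

{-# OPTIONS --safe #-}
module Submission where

-- Let C be an isotropic component of Ĝ_C(P^∨) and i the index of one of its elements.  A root of P
-- joining a and b in Σ_P has coroot s₁e_a + s₂e_b (with a = b, s₁ = s₂ for a loop) and contributes the
-- generators (s₁,a) < (-s₂,b) and (s₂,b) < (-s₁,a); whatever the sign s at a, one of them puts
-- (s,a) next to some (s',b), and the edge is negative iff s ≠ s'.  Walking along Σ_P from i therefore
-- attaches to every vertex a of its component a sign s_a with (s_a,a) ∈ C, unique because C is
-- isotropic, and every edge ab of the component is negative iff s_a ≠ s_b.  Around a cycle the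
-- number of negative edges is then the number of sign changes, which is even.

open import Defs
open import Data.Nat using (ℕ; zero; suc; _+_; _%_; parity)
open import Data.Parity as ℙ using (Parity; 0ℙ; 1ℙ; _⁻¹)
open import Data.Parity.Properties using (p+p≡0ℙ; +-assoc; +-comm; +-homo-+)
open import Data.Bool using (Bool; if_then_else_)
open import Data.Fin using (Fin; inject₁; fromℕ) renaming (zero to fzero; suc to fsuc)
open import Data.Product using (Σ; _×_; _,_; proj₁; proj₂)
open import Data.Sum using (inj₁; inj₂)
open import Data.List using (tabulate)
open import Data.List.Properties using (map-tabulate)
open import Data.Nat.ListAction using (sum)
open import Data.Empty using (⊥-elim)
open import Function using (id; _∘_)
open import Relation.Binary.PropositionalEquality using (_≡_; refl; sym; trans; cong; cong₂; subst; module ≡-Reasoning)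
open import Relation.Binary.Construct.Closure.ReflexiveTransitive using (ε; _◅_; _◅◅_; return)

open ≡-Reasoning

+-telescope : ∀ p q r → (p ℙ.+ q) ℙ.+ (q ℙ.+ r) ≡ p ℙ.+ r
+-telescope p q r = begin
  (p ℙ.+ q) ℙ.+ (q ℙ.+ r)  ≡⟨ +-assoc p q (q ℙ.+ r) ⟩
  p ℙ.+ (q ℙ.+ (q ℙ.+ r))  ≡⟨ cong (p ℙ.+_) (sym (+-assoc q q r)) ⟩
  p ℙ.+ ((q ℙ.+ q) ℙ.+ r)  ≡⟨ cong (λ z → p ℙ.+ (z ℙ.+ r)) (p+p≡0ℙ q) ⟩
  p ℙ.+ r                  ∎

parity-sum-telescopes : ∀ {k} (h : Fin (suc k) → Parity) (f : Fin k → ℕ) →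
  (∀ m → parity (f m) ≡ h (inject₁ m) ℙ.+ h (fsuc m)) →
  parity (sum (tabulate f)) ≡ h fzero ℙ.+ h (fromℕ k)
parity-sum-telescopes {zero}  h f step = sym (p+p≡0ℙ (h fzero))
parity-sum-telescopes {suc k} h f step = begin
  parity (f fzero + sum (tabulate (f ∘ fsuc)))
    ≡⟨ +-homo-+ (f fzero) _ ⟩
  parity (f fzero) ℙ.+ parity (sum (tabulate (f ∘ fsuc)))
    ≡⟨ cong₂ ℙ._+_ (step fzero) (parity-sum-telescopes (h ∘ fsuc) (f ∘ fsuc) (step ∘ fsuc)) ⟩
  (h fzero ℙ.+ h (fsuc fzero)) ℙ.+ (h (fsuc fzero) ℙ.+ h (fromℕ (suc k)))
    ≡⟨ +-telescope (h fzero) (h (fsuc fzero)) (h (fromℕ (suc k))) ⟩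
  h fzero ℙ.+ h (fromℕ (suc k))
    ∎

parity≡0ℙ⇒%2≡0 : ∀ n → parity n ≡ 0ℙ → n % 2 ≡ 0
parity≡0ℙ⇒%2≡0 zero          _  = refl
parity≡0ℙ⇒%2≡0 (suc zero)    ()
parity≡0ℙ⇒%2≡0 (suc (suc n)) eq = parity≡0ℙ⇒%2≡0 n eq

signParity : Sign → Parity
signParity plus  = 0ℙ
signParity minus = 1ℙ

edgeParity : ∀ {n} → Root n → Parity
edgeParity α = parity (if isNeg α then 1 else 0)

edgeParity-long : ∀ {n} s t {i j : Fin n} {i<j} →
  edgeParity (long s t i j i<j) ≡ (signParity s ℙ.+ signParity t) ⁻¹
edgeParity-long plus  plus  = refl
edgeParity-long plus  minus = refl
edgeParity-long minus plus  = refl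
edgeParity-long minus minus = refl

negCount-even : ∀ {n P k} (c : Cycle {n} P k) (h : Fin (suc (suc k)) → Parity) →
  (∀ m → edgeParity (Cycle.e c m) ≡ h (inject₁ m) ℙ.+ h (fsuc m)) →
  h fzero ≡ h (fromℕ (suc k)) →
  negCount c % 2 ≡ 0
negCount-even {k = k} c h edge closed = parity≡0ℙ⇒%2≡0 (negCount c) (begin
  parity (negCount c)                          ≡⟨ cong (parity ∘ sum) (map-tabulate id indicator) ⟩
  parity (sum (tabulate indicator))            ≡⟨ parity-sum-telescopes h indicator edge ⟩
  h fzero ℙ.+ h (fromℕ (suc k))                ≡⟨ cong (h fzero ℙ.+_) (sym closed) ⟩
  h fzero ℙ.+ h fzero                          ≡⟨ p+p≡0ℙ (h fzero) ⟩
  0ℙ                                           ∎)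
  where
  indicator : Fin (suc k) → ℕ
  indicator m = if isNeg (Cycle.e c m) then 1 else 0

module _ {n : ℕ} (P : Root n → Bool) where

  generator-pair-comparable : ∀ {s₁ s₂ a b} →
    GenRel P (s₁ , a) (flipS s₂ , b) → GenRel P (s₂ , b) (flipS s₁ , a) →
    ∀ s → Σ Sign λ s' → GCComparable P (s , a) (s' , b) ×
                        (signParity s₁ ℙ.+ signParity s₂) ⁻¹ ≡ signParity s ℙ.+ signParity s'
  -- forwards along the first generator when s = s₁, backwards along the second when s = -s₁
  generator-pair-comparable {plus}  {plus}  g₁ g₂ plus  = _ , inj₁ (return g₁) , refl
  generator-pair-comparable {plus}  {minus} g₁ g₂ plus  = _ , inj₁ (return g₁) , refl
  generator-pair-comparable {minus} {plus}  g₁ g₂ minus = _ , inj₁ (return g₁) , refl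
  generator-pair-comparable {minus} {minus} g₁ g₂ minus = _ , inj₁ (return g₁) , refl
  generator-pair-comparable {plus}  {plus}  g₁ g₂ minus = _ , inj₂ (return g₂) , refl
  generator-pair-comparable {plus}  {minus} g₁ g₂ minus = _ , inj₂ (return g₂) , refl
  generator-pair-comparable {minus} {plus}  g₁ g₂ plus  = _ , inj₂ (return g₂) , refl
  generator-pair-comparable {minus} {minus} g₁ g₂ plus  = _ , inj₂ (return g₂) , refl

  root-generators : ∀ {α a b} → α ∈P P → Joins α a b →
    Σ Sign λ s₁ → Σ Sign λ s₂ →
      GenRel P (s₁ , a) (flipS s₂ , b) × GenRel P (s₂ , b) (flipS s₁ , a) ×
      edgeParity α ≡ (signParity s₁ ℙ.+ signParity s₂) ⁻¹
  root-generators {short s₀ i} α∈P (refl , refl) =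
    s₀ , s₀ , gen-short s₀ i α∈P , gen-short s₀ i α∈P , sym (cong _⁻¹ (p+p≡0ℙ (signParity s₀)))
  root-generators {long s₀ t₀ i j i<j} α∈P (inj₁ (refl , refl)) =
    s₀ , t₀ , gen-long₁ s₀ t₀ i j i<j α∈P , gen-long₂ s₀ t₀ i j i<j α∈P , edgeParity-long s₀ t₀
  root-generators {long s₀ t₀ i j i<j} α∈P (inj₂ (refl , refl)) =
    t₀ , s₀ , gen-long₂ s₀ t₀ i j i<j α∈P , gen-long₁ s₀ t₀ i j i<j α∈P ,
    trans (edgeParity-long s₀ t₀) (cong _⁻¹ (+-comm (signParity s₀) (signParity t₀)))

  edge-comparable : ∀ {α a b} → α ∈P P → Joins α a b →
    ∀ s → Σ Sign λ s' → GCComparable P (s , a) (s' , b) ×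
                        edgeParity α ≡ signParity s ℙ.+ signParity s'
  edge-comparable α∈P joins s with root-generators α∈P joins
  ... | _ , _ , g₁ , g₂ , αParity with generator-pair-comparable g₁ g₂ s
  ...   | s' , comparable , pairParity = s' , comparable , trans αParity pairParity

module IsotropicComponent {n : ℕ} (P : Root n → Bool) (x : SElt n)
                          (isotropic : IsotropicComponentOf P x) where

  component-sign-unique : ∀ {s s' i} → GCConn P x (s , i) → GCConn P x (s' , i) → s ≡ s'
  component-sign-unique {plus}  {plus}      _   _   = refl
  component-sign-unique {minus} {minus}     _   _   = refl
  component-sign-unique {plus}  {minus} {i} x~+i x~-i = ⊥-elim (isotropic (i , x~+i , x~-i))
  component-sign-unique {minus} {plus}  {i} x~-i x~+i = ⊥-elim (isotropic (i , x~+i , x~-i))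

  component-sign-exists : ∀ {s a b} → GCConn P x (s , a) → SigConn P a b →
                          Σ Sign λ s' → GCConn P x (s' , b)
  component-sign-exists x~sa ε = _ , x~sa
  component-sign-exists {s} x~sa ((α , (α∈P , _) , joins) ◅ path)
    with edge-comparable P α∈P joins s
  ... | _ , comparable , _ = component-sign-exists (x~sa ◅◅ return comparable) path

  component-edgeParity : ∀ {s s' a b α} → GCConn P x (s , a) → GCConn P x (s' , b) →
                         α ∈P P → Joins α a b → edgeParity α ≡ signParity s ℙ.+ signParity s'
  component-edgeParity {s} x~sa x~s'b α∈P joins with edge-comparable P α∈P joins s
  ... | _ , comparable , αParity =
    trans αParity (cong (λ t → signParity s ℙ.+ signParity t)
                        (component-sign-unique (x~sa ◅◅ return comparable) x~s'b))

  isotropic⇒balanced : BalancedComponentOf P (proj₂ x)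
  isotropic⇒balanced k c x~v = negCount-even c potential edge-ok closed-ok
    where
    open Cycle c
    sign : ∀ m → Σ Sign λ s → GCConn P x (s , v m)
    sign m = component-sign-exists ε (x~v m)

    potential : Fin (suc (suc k)) → Parity
    potential = signParity ∘ proj₁ ∘ sign

    edge-ok : ∀ m → edgeParity (e m) ≡ potential (inject₁ m) ℙ.+ potential (fsuc m)
    edge-ok m = component-edgeParity (proj₂ (sign (inject₁ m))) (proj₂ (sign (fsuc m)))
                                     (proj₁ (e-edge m)) (e-join m)

    closed-ok : potential fzero ≡ potential (fromℕ (suc k))
    closed-ok = cong signParity (component-sign-unique (proj₂ (sign fzero)) x~last)
      where
      x~last : GCConn P x (proj₁ (sign (fromℕ (suc k))) , v fzero)
      x~last = subst (λ w → GCConn P x (proj₁ (sign (fromℕ (suc k))) , w)) closed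
                     (proj₂ (sign (fromℕ (suc k))))

mainTheorem11 : (n : ℕ) (P : Root n → Bool) → IsSignedPoset P →
    HasIsotropicComponent P → HasBalancedComponent P
mainTheorem11 n P _ (x , isotropic) = proj₂ x , IsotropicComponent.isotropic⇒balanced P x isotropic
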